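{- Let $G$ be a ribbon graph with dual $G^*$. Identify the topological medial graphs $G_m$ and $G^*_m$ (which are the same embedded graph). Then $$Q(G^*_m;W(G^*_m),t)=Q(G_m;W^*(G_m),t),$$ where $W(G^*_m)$ is the medial weight system of $G^*_m$ relative to $G^*$, and $W^*(G_m)$ is the dual weight system of $G_m$ relative to $G$.
   Context: A ribbon graph $G$ is a graph cellularly embedded in a surface; $G^*$ is its geometric dual in the same surface. The topological medial graph $G_m$ has a vertex on each edge of $G$ and edges running around the faces of $G$ between consecutive half-edges; $G_m$ and $G^*_m$ coincide as embedded graphs, each vertex of $G_m$ lying on an edge $e$ of $G$ and the dual edge $e^*$ of $G^*$. The medial weight system $W$ of $G_m$ relative to $G$ assigns to a pair of $G_m$-half-edges at a vertex on $e$ the weight $\sqrt\alpha$ if they are consecutive in the rotation with no half-edge of $e$ between them, $\sqrt\beta$ if consecutive with a half-edge of $e$ between them, and $0$ otherwise; so the "uncut" vertex state (leaving the ribbon of $e$ intact) has weight $\alpha$ and the "cut" state weight $\beta$. The dual weight system $W^*$ is obtained by exchanging the roles of $\alpha$ and $\beta$. A graph state $S$ chooses a pairing of half-edges at each vertex; $\omega(S)$ is the product of the pair weights, $c(S)$ the number of resulting closed curves, and $Q(G_m;W,t)=\sum_S\omega(S)t^{c(S)}$. -}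

module Defs where

open import Level using (Level)
open import Data.Nat using (ℕ; zero; suc)
open import Data.Fin using (Fin; zero; suc; toℕ; _≟_)
open import Data.Bool using (Bool; true; false; if_then_else_; _∧_; _∨_; not)
open import Data.List using (List; []; _∷_; [_]; map; concatMap; allFin; foldr; upTo; length; filter)
open import Data.Bool.ListAction using (all; any)
open import Relation.Nullary.Decidable using (⌊_⌋)
open import Relation.Binary.PropositionalEquality using (_≡_)
open import Data.Nat using (_<ᵇ_)
open import Algebra.Bundles using (CommutativeRing)

-- Ribbon graphs as generalized combinatorial maps (flag representation).
-- Flags : Fin n.  τ₀ : change vertex (other end of the edge),
-- τ₁ : change edge (other edge in the same corner),
-- τ₂ : change side (other side of the edge ribbon).
-- vertices = ⟨τ₁,τ₂⟩-orbits, edges = ⟨τ₀,τ₂⟩-orbits, faces = ⟨τ₀,τ₁⟩-orbits.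
-- Isolated vertices (carrying no flags) are recorded by a counter.

Involution : {n : ℕ} → (Fin n → Fin n) → Set
Involution {n} τ = (x : Fin n) → τ (τ x) ≡ x

FixedPointFree : {n : ℕ} → (Fin n → Fin n) → Set
FixedPointFree {n} τ = (x : Fin n) → τ x ≡ x → Data.Empty.⊥
  where import Data.Empty

record RibbonGraph : Set where
  field
    nflags   : ℕ
    τ₀ τ₁ τ₂ : Fin nflags → Fin nflags
    τ₀-inv   : Involution τ₀
    τ₁-inv   : Involution τ₁
    τ₂-inv   : Involution τ₂
    τ₀-fpf   : FixedPointFree τ₀
    τ₁-fpf   : FixedPointFree τ₁
    τ₂-fpf   : FixedPointFree τ₂
    τ₀τ₂-comm : (x : Fin nflags) → τ₀ (τ₂ x) ≡ τ₂ (τ₀ x)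
    τ₀τ₂-fpf : FixedPointFree (λ x → τ₀ (τ₂ x))
    isolated : ℕ

dual : RibbonGraph → RibbonGraph
dual G = record
  { nflags = nflags ; τ₀ = τ₂ ; τ₁ = τ₁ ; τ₂ = τ₀
  ; τ₀-inv = τ₂-inv ; τ₁-inv = τ₁-inv ; τ₂-inv = τ₀-inv
  ; τ₀-fpf = τ₂-fpf ; τ₁-fpf = τ₁-fpf ; τ₂-fpf = τ₀-fpf
  ; τ₀τ₂-comm = λ x → Relation.Binary.PropositionalEquality.sym (τ₀τ₂-comm x)
  ; τ₀τ₂-fpf = λ x p → τ₀τ₂-fpf x (Relation.Binary.PropositionalEquality.trans (τ₀τ₂-comm x) p)
  ; isolated = isolated }
  where open RibbonGraph G

_==_ : {n : ℕ} → Fin n → Fin n → Bool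
x == y = ⌊ x ≟ y ⌋

-- Half-edges : Fin n; medial edges are the
-- pairs {h, edge h}; sameVertex h h' says h, h' are half-edges at the
-- same vertex; freeLoops counts vertex-free closed curves.

record FourRegularGraph : Set where
  field
    nhalf      : ℕ
    edge       : Fin nhalf → Fin nhalf
    sameVertex : Fin nhalf → Fin nhalf → Bool
    freeLoops  : ℕ

-- Topological medial graph G_m: a vertex on each edge e of G whose four
-- half-edges are the four flags of e; the half-edge of flag x runs to the
-- corner {x, τ₁ x}, so the medial edges are the τ₁-pairs of flags.
-- An isolated vertex of G yields a free loop of G_m.
medial : RibbonGraph → FourRegularGraph
medial G = record
  { nhalf = nflags
  ; edge = τ₁
  ; sameVertex = λ x y → (y == τ₀ x) ∨ (y == τ₂ x) ∨ (y == τ₀ (τ₂ x))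
  ; freeLoops = isolated }
  where open RibbonGraph G

-- Weight systems with values in a commutative ring R.  The parameters
-- a b : R play the roles of √α and √β (so α = a*a, β = b*b).

module _ {c ℓ : Level} (R : CommutativeRing c ℓ) where
  open CommutativeRing R renaming (Carrier to K)

  WeightSystem : FourRegularGraph → Set c
  WeightSystem M = Fin (FourRegularGraph.nhalf M) → Fin (FourRegularGraph.nhalf M) → K

  -- Around the medial vertex
  -- on e the cyclic order is x, τ₀x, τ₀τ₂x, τ₂x; the half-edges of e lie
  -- between x and τ₂x (and τ₀x, τ₀τ₂x); those of e* between x and τ₀x.
  -- Consecutive without half-edge of e between: {x, τ₀x}  ↦ √α
  -- Consecutive with half-edge of e between:    {x, τ₂x}  ↦ √β
  -- Otherwise ({x, τ₀τ₂x}):                               ↦ 0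
  medialWeight : (G : RibbonGraph) → (sa sb : K) → WeightSystem (medial G)
  medialWeight G sa sb x y =
    if y == τ₀ x then sa else (if y == τ₂ x then sb else 0#)
    where open RibbonGraph G

  dualWeight : (G : RibbonGraph) → (sa sb : K) → WeightSystem (medial G)
  dualWeight G sa sb = medialWeight G sb sa

  pow : K → ℕ → K
  pow x zero = 1#
  pow x (suc k) = x * pow x k

  sumK : List K → K
  sumK = foldr _+_ 0#

  prodK : List K → K
  prodK = foldr _*_ 1#

  allFuns : (n m : ℕ) → List (Fin n → Fin m)
  allFuns zero m = [ (λ ()) ]
  allFuns (suc n) m = concatMap (λ f → map (λ i → cons i f) (allFin m)) (allFuns n m)
    where
      cons : Fin m → (Fin n → Fin m) → Fin (suc n) → Fin m
      cons i f zero = i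
      cons i f (suc k) = f k

  iter : {n : ℕ} → (Fin n → Fin n) → ℕ → Fin n → Fin n
  iter π zero x = x
  iter π (suc k) x = π (iter π k x)

  module _ (M : FourRegularGraph) where
    open FourRegularGraph M

    isState : (Fin nhalf → Fin nhalf) → Bool
    isState s = all (λ x → (s (s x) == x) ∧ not (s x == x) ∧ sameVertex x (s x)) (allFin nhalf)

    stateWeight : WeightSystem M → (Fin nhalf → Fin nhalf) → K
    stateWeight W s = prodK (map (λ x → if toℕ x <ᵇ toℕ (s x) then W x (s x) else 1#) (allFin nhalf))

    -- The closed curve through half-edge x: alternate the state pairing s
    -- and traversal of medial edges; its half-edges are π^i x and s(π^i x)
    -- with π = edge ∘ s.
    onCurve : (Fin nhalf → Fin nhalf) → Fin nhalf → Fin nhalf → Bool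
    onCurve s x y = any (λ i → (y == iter (λ z → edge (s z)) i x) ∨ (y == s (iter (λ z → edge (s z)) i x))) (upTo nhalf)

    -- c(S): number of closed curves = number of curves through half-edges
    -- (counted by their least half-edge) plus free loops.
    curves : (Fin nhalf → Fin nhalf) → ℕ
    curves s = length (filter (λ x → not (any (λ y → onCurve s x y ∧ (toℕ y <ᵇ toℕ x)) (allFin nhalf)) Data.Bool.≟ true) (allFin nhalf)) Data.Nat.+ freeLoops
      where import Data.Bool; import Data.Nat

    Q : WeightSystem M → K → K
    Q W t = sumK (map (λ s → if isState s then stateWeight W s * pow t (curves s) else 0#) (allFuns nhalf nhalf))

-- On the shared medial graph the flags, the medial edges (τ₁-pairs) and the
-- free loops are the same for G and G*, and the four half-edges at the vertex
-- on e are {x, τ₀x, τ₂x, τ₀τ₂x} in both; only the roles of τ₀ and τ₂ swap.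
-- Hence G_m and G*_m have the same graph states and the same curve counts,
-- and the medial weight of G* (√α on τ₂-pairs, √β on τ₀-pairs) is exactly the
-- dual weight of G, so Q agrees state by state.
module Submission where

open import Defs
open import Level using (Level)
open import Algebra.Bundles using (CommutativeRing)
open import Data.Nat using (ℕ; _<ᵇ_)
open import Data.Fin using (Fin; _≟_; toℕ)
open import Data.Bool using (Bool; true; false; _∨_; _∧_; not; if_then_else_)
open import Data.List using (foldr; allFin)
open import Data.List.Properties using (map-cong)
open import Relation.Nullary using (yes; no; contradiction)
open import Relation.Binary.PropositionalEquality

∨-swapˡ : (a b c : Bool) → a ∨ (b ∨ c) ≡ b ∨ (a ∨ c)
∨-swapˡ true  true  c = refl
∨-swapˡ true  false c = refl
∨-swapˡ false true  c = refl
∨-swapˡ false false c = refl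

module _ {c ℓ : Level} (R : CommutativeRing c ℓ) where
  open CommutativeRing R using (_+_; _*_; 0#; 1#)

  module _ {n : ℕ} (edge : Fin n → Fin n) (freeLoops : ℕ)
           {sv sv′ : Fin n → Fin n → Bool} (sv≗sv′ : ∀ x y → sv x y ≡ sv′ x y) where

    private
      M M′ : FourRegularGraph
      M  = record { nhalf = n ; edge = edge ; sameVertex = sv  ; freeLoops = freeLoops }
      M′ = record { nhalf = n ; edge = edge ; sameVertex = sv′ ; freeLoops = freeLoops }

    isState-cong-sameVertex : ∀ s → isState R M s ≡ isState R M′ s
    isState-cong-sameVertex s = cong (foldr _∧_ true)
      (map-cong (λ x → cong (λ b → (s (s x) == x) ∧ not (s x == x) ∧ b) (sv≗sv′ x (s x))) (allFin n))

    Q-cong : {W : WeightSystem R M} {W′ : WeightSystem R M′} →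
             (∀ x y → W x y ≡ W′ x y) → ∀ t → Q R M W t ≡ Q R M′ W′ t
    -- curves never reads sameVertex, so both sides share the factor t^c(S) definitionally.
    Q-cong {W} {W′} W≗W′ t = cong (foldr _+_ 0#)
      (map-cong (λ s → cong₂ (λ b w → if b then w * pow R t (curves R M s) else 0#)
                             (isState-cong-sameVertex s) (stateWeight-cong s))
                (allFuns R n n))
      where
      stateWeight-cong : ∀ s → stateWeight R M W s ≡ stateWeight R M′ W′ s
      stateWeight-cong s = cong (foldr _*_ 1#)
        (map-cong (λ x → cong (λ w → if toℕ x <ᵇ toℕ (s x) then w else 1#) (W≗W′ x (s x))) (allFin n))

module _ (G : RibbonGraph) where
  open RibbonGraph G

  τ₀≢τ₂ : ∀ x → τ₀ x ≢ τ₂ x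
  τ₀≢τ₂ x τ₀x≡τ₂x = τ₀τ₂-fpf x (trans (cong τ₀ (sym τ₀x≡τ₂x)) (τ₀-inv x))

  sameVertex-dual : ∀ x y → FourRegularGraph.sameVertex (medial (dual G)) x y
                          ≡ FourRegularGraph.sameVertex (medial G) x y
  sameVertex-dual x y rewrite τ₀τ₂-comm x = ∨-swapˡ (y == τ₂ x) (y == τ₀ x) (y == τ₂ (τ₀ x))

  medialWeight-dual : ∀ {c ℓ} (R : CommutativeRing c ℓ) sa sb x y →
                      medialWeight R (dual G) sa sb x y ≡ dualWeight R G sa sb x y
  medialWeight-dual R sa sb x y with y ≟ τ₂ x | y ≟ τ₀ x
  ... | yes y≡τ₂x | yes y≡τ₀x = contradiction (trans (sym y≡τ₀x) y≡τ₂x) (τ₀≢τ₂ x)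
  ... | yes _ | no _  = refl
  ... | no _  | yes _ = refl
  ... | no _  | no _  = refl

theorem5p1 : {c ℓ : Level} (R : CommutativeRing c ℓ) (G : RibbonGraph)
    (sa sb t : CommutativeRing.Carrier R) →
    CommutativeRing._≈_ R
      (Q R (medial (dual G)) (medialWeight R (dual G) sa sb) t)
      (Q R (medial G) (dualWeight R G sa sb) t)
theorem5p1 R G sa sb t = CommutativeRing.reflexive R
  (Q-cong R τ₁ isolated (sameVertex-dual G) (medialWeight-dual G R sa sb) t)
  where open RibbonGraph G
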